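{- Let $M\ge 0$, $k\ge 1$, $m\ge 0$ be integers. Let $\mathcal{P}_l(k,m)$ be the set of partitions $(\lambda_1,\dots,\lambda_l)$ into exactly $l$ parts with $\lambda_l\ge k$ and $\lambda_i-\lambda_{i+1}\ge m$ for $1\le i\le l-1$ ($\mathcal{P}_0(k,m)$ containing only the empty partition), and let $\mathcal{P}_{\le M}(k,m)=\bigcup_{l=0}^M\mathcal{P}_l(k,m)$. For a nonempty partition $\pi=(\lambda_1,\dots,\lambda_l)$ define \[\omega_{k,m}(\pi):=(\lambda_l+1-k)\prod_{i=1}^{l-1}(\lambda_i-\lambda_{i+1}+1-m),\] and let the weight of the empty partition be $1$. Then \[\sum_{\pi\in\mathcal{P}_{\le M}(k,m)}\omega_{k,m}(\pi)\,q^{|\pi|}=\sum_{i=0}^{M}\frac{q^{m\binom{i}{2}+ki}}{(q;q)_i^2}.\]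
   Context: A partition is a finite weakly decreasing sequence of positive integers; $|\pi|$ is the sum of its parts. $(a;q)_L:=\prod_{n=0}^{L-1}(1-aq^n)$, with $(a;q)_0=1$. -}

module Defs where

open import Data.Nat as ℕ using (ℕ; zero; suc; _≤ᵇ_; _≡ᵇ_; _≤_)
open import Data.Nat.Combinatorics using (_C_)
open import Data.Integer using (ℤ; +_; _+_; _-_; _*_; -_)
open import Data.Bool using (Bool; true; false; _∧_; if_then_else_)
open import Data.List using (List; []; _∷_; map; concatMap; upTo)
import Data.List as L
import Data.Nat.ListAction as ListAction
open import Relation.Binary.PropositionalEquality using (_≡_)

-- Formal power series in q with integer coefficients: n ↦ [q^n] f

Series : Set
Series = ℕ → ℤ

_≋_ : Series → Series → Set
f ≋ g = ∀ n → f n ≡ g n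

sumTo : ℕ → (ℕ → ℤ) → ℤ
sumTo zero    h = h 0
sumTo (suc n) h = sumTo n h + h (suc n)

_⊛_ : Series → Series → Series
(f ⊛ g) n = sumTo n (λ j → f j * g (n ℕ.∸ j))

one : Series
one zero    = + 1
one (suc _) = + 0

-- the polynomial 1 - q^(suc a)
oneMinusQ : ℕ → Series
oneMinusQ a zero    = + 1
oneMinusQ a (suc n) = if n ≡ᵇ a then - (+ 1) else + 0

-- (q;q)_i = ∏_{n=0}^{i-1} (1 - q^{n+1}), with (q;q)_0 = 1
qPoch : ℕ → Series
qPoch zero    = one
qPoch (suc i) = qPoch i ⊛ oneMinusQ i

shift : ℕ → Series → Series
shift e f n = if e ≤ᵇ n then f (n ℕ.∸ e) else + 0

-- Partitions (as lists λ₁ ∷ λ₂ ∷ … ∷ λ_l ∷ [])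

lists : ℕ → ℕ → List (List ℕ)
lists zero    n = [] ∷ []
lists (suc l) n = concatMap (λ x → map (x ∷_) (lists l n)) (upTo (suc n))

-- membership test for P_l(k,m) (l = length of the list):
-- weakly decreasing, λ_l ≥ k, λ_i - λ_{i+1} ≥ m.
-- (Positivity of parts follows from λ_l ≥ k ≥ 1, assumed in the statement.)
inP : ℕ → ℕ → List ℕ → Bool
inP k m []            = true
inP k m (x ∷ [])      = k ≤ᵇ x
inP k m (x ∷ y ∷ r)   = (y ≤ᵇ x) ∧ ((y ℕ.+ m) ≤ᵇ x) ∧ inP k m (y ∷ r)

ω : ℕ → ℕ → List ℕ → ℤ
ω k m []          = + 1
ω k m (x ∷ [])    = + x + + 1 - + k
ω k m (x ∷ y ∷ r) = (+ x - + y + + 1 - + m) * ω k m (y ∷ r)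

sumList : List ℤ → ℤ
sumList = L.foldr _+_ (+ 0)

-- coefficient of q^n in Σ_{π ∈ P_{≤M}(k,m)} ω_{k,m}(π) q^{|π|}.
-- A partition of n has all parts ≤ n, so `lists l n` enumerates all candidates.
lhsSeries : ℕ → ℕ → ℕ → Series
lhsSeries M k m n =
  sumTo M (λ l → sumList (map (λ π → if inP k m π ∧ (ListAction.sum π ≡ᵇ n) then ω k m π else + 0)
                             (lists l n)))

-- Σ_{i=0}^{M} q^{m·C(i,2) + k·i} · D i, where D i is meant to be 1/(q;q)_i^2
rhsSeries : ℕ → ℕ → ℕ → (ℕ → Series) → Series
rhsSeries M k m D n = sumTo M (λ i → shift (m ℕ.* (i C 2) ℕ.+ k ℕ.* i) (D i) n)

module Submission where

-- Fix m and let W l k be the weighted generating function of P_l(k,m).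
-- The heart of the proof is the identity, proved by induction on l,
--     (main)   W l k · (q;q)_l² = q^{m·C(l,2) + k·l}.
-- Removing the smallest part z of a partition in P_{l+1}(k,m) leaves one in
-- P_l(z+m,m) and contributes the factor (z+1-k) q^z; so with
-- Tail l k = Σ_{z ≥ k} q^z W l (z+m) we get
--     W (l+1) k - W (l+1) (k+1) = Tail l k,   Tail l k - Tail l (k+1) = q^k W l (k+m).
-- Both families vanish below degree k, so each is a telescoping tail, and
-- multiplying such a tail by (1 - q^{l+1}) leaves only its first term.  Doing
-- this twice, with (q;q)_{l+1}² = (1-q^{l+1})² (q;q)_l² and the induction
-- hypothesis, gives (main) for l+1.  corollary6 follows by cancelling
-- (q;q)_l² (constant term 1) and summing over l ≤ M.

open import Defs
open import Data.Nat using (ℕ; _≤_)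
open import Data.Nat as ℕ using (zero; suc; _≤ᵇ_; _≡ᵇ_; _<_; s≤s; z≤n; _≤?_; _∸_)
import Data.Nat.Properties as NP
import Data.Nat.Tactic.RingSolver as NatSolver
open import Data.Nat.Combinatorics using (_C_; nCk+nC[k+1]≡[n+1]C[k+1]; nC1≡n)
import Data.Nat.ListAction as ListAction
open import Data.Integer using (ℤ; +_; _+_; _-_; _*_)
import Data.Integer.Properties as ZP
open import Data.Integer.Tactic.RingSolver using (solve-∀)
open import Algebra.Bundles using (AbelianGroup)
open import Algebra.Properties.Group (AbelianGroup.group ZP.+-0-abelianGroup)
  using () renaming (∙-cancelˡ to +-cancelˡ)
open import Data.Bool using (Bool; true; false; T; if_then_else_; _∧_)
import Data.Bool.Properties as BP
open import Data.Unit using (tt)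
open import Data.Empty using (⊥-elim)
open import Data.Sum using (inj₁; inj₂)
open import Data.List using (List; []; _∷_; map; concatMap; upTo; _++_; applyUpTo)
open import Data.List.Relation.Unary.Any using (Any; here; there)
open import Function using (_∘_)
open import Function.Bundles using (Equivalence)
open import Relation.Nullary using (¬_; yes; no)
open import Relation.Binary.PropositionalEquality

T⇒true : ∀ {b} → T b → b ≡ true
T⇒true = Equivalence.to BP.T-≡

≤ᵇ-true : ∀ {a n} → a ≤ n → (a ≤ᵇ n) ≡ true
≤ᵇ-true p = T⇒true (NP.≤⇒≤ᵇ p)

≤ᵇ-false : ∀ {a n} → ¬ a ≤ n → (a ≤ᵇ n) ≡ false
≤ᵇ-false {a} {n} p with a ≤ᵇ n in eq
... | true  = ⊥-elim (p (NP.≤ᵇ⇒≤ a n (subst T (sym eq) tt)))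
... | false = refl

T-ext : ∀ {b c : Bool} → (T b → T c) → (T c → T b) → b ≡ c
T-ext {true}  {true}  _ _ = refl
T-ext {true}  {false} f _ = ⊥-elim (f tt)
T-ext {false} {true}  _ g = ⊥-elim (g tt)
T-ext {false} {false} _ _ = refl

guard-*ʳ : ∀ (b : Bool) (x y : ℤ) → (if b then x else + 0) * y ≡ (if b then x * y else + 0)
guard-*ʳ true  x y = refl
guard-*ʳ false x y = refl

guard-*ˡ : ∀ (b : Bool) (x y : ℤ) → y * (if b then x else + 0) ≡ (if b then y * x else + 0)
guard-*ˡ true  x y = refl
guard-*ˡ false x y = ZP.*-zeroʳ y

sumTo-cong : ∀ n {f g : ℕ → ℤ} → (∀ j → j ≤ n → f j ≡ g j) → sumTo n f ≡ sumTo n g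
sumTo-cong zero    e = e 0 z≤n
sumTo-cong (suc n) e =
  cong₂ _+_ (sumTo-cong n (λ j p → e j (NP.m≤n⇒m≤1+n p))) (e (suc n) NP.≤-refl)

sumTo-zero : ∀ n (f : ℕ → ℤ) → (∀ j → j ≤ n → f j ≡ + 0) → sumTo n f ≡ + 0
sumTo-zero zero    f z = z 0 z≤n
sumTo-zero (suc n) f z =
  cong₂ _+_ (sumTo-zero n f (λ j p → z j (NP.m≤n⇒m≤1+n p))) (z (suc n) NP.≤-refl)

sumTo-− : ∀ n (f g : ℕ → ℤ) → sumTo n (λ j → f j - g j) ≡ sumTo n f - sumTo n g
sumTo-− zero    f g = refl
sumTo-− (suc n) f g =
  trans (cong (_+ (f (suc n) - g (suc n))) (sumTo-− n f g))
        (regroup (sumTo n f) (sumTo n g) (f (suc n)) (g (suc n)))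
  where regroup : ∀ a b c d → (a - b) + (c - d) ≡ (a + c) - (b + d)
        regroup = solve-∀

sumTo-unconsˡ : ∀ n (f : ℕ → ℤ) → sumTo (suc n) f ≡ f 0 + sumTo n (f ∘ suc)
sumTo-unconsˡ zero    f = refl
sumTo-unconsˡ (suc n) f =
  trans (cong (_+ f (suc (suc n))) (sumTo-unconsˡ n f)) (ZP.+-assoc (f 0) _ _)

sumTo-extend : ∀ {n} N (f : ℕ → ℤ) → n ≤ N → (∀ j → n < j → j ≤ N → f j ≡ + 0) →
               sumTo N f ≡ sumTo n f
sumTo-extend zero    f z≤n z = refl
sumTo-extend {n} (suc N) f p z with n ≤? N
... | yes q = trans (cong₂ _+_ (sumTo-extend N f q (λ j a b → z j a (NP.m≤n⇒m≤1+n b)))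
                               (z (suc N) (s≤s q) NP.≤-refl))
                    (ZP.+-identityʳ _)
... | no q with NP.≤-antisym p (NP.≰⇒> q)
... | refl = refl

sumTo-delay : ∀ n a (F : ℕ → ℤ) →
  sumTo n (λ j → if a ≤ᵇ j then F (j ∸ a) else + 0) ≡ (if a ≤ᵇ n then sumTo (n ∸ a) F else + 0)
sumTo-delay zero zero    F = refl
sumTo-delay zero (suc a) F = refl
sumTo-delay (suc n) a F with a ≤? n
... | yes p rewrite sumTo-delay n a F | ≤ᵇ-true p | ≤ᵇ-true (NP.m≤n⇒m≤1+n p)
                  | NP.+-∸-assoc 1 p = refl
... | no p with a ≤? suc n
...   | yes q rewrite sumTo-delay n a F | ≤ᵇ-false p | ≤ᵇ-true q
                    | NP.≤-antisym q (NP.≰⇒> p) | NP.n∸n≡0 n = ZP.+-identityˡ _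
...   | no q rewrite sumTo-delay n a F | ≤ᵇ-false p | ≤ᵇ-false q = refl

sumTo-truncate : ∀ n N (H : ℕ → ℤ) → N ≤ n →
  sumTo n (λ j → if j ≤ᵇ N then H j else + 0) ≡ sumTo N H
sumTo-truncate n N H p =
  trans (sumTo-extend n _ p (λ j a _ → cong (λ b → if b then H j else + 0) (≤ᵇ-false (NP.<⇒≱ a))))
        (sumTo-cong N (λ j q → cong (λ b → if b then H j else + 0) (≤ᵇ-true q)))

sumTo-peel : ∀ n k (h : ℕ → ℤ) →
  sumTo n (λ z → if k ≤ᵇ z then h z else + 0)
    ≡ (if k ≤ᵇ n then h k else + 0) + sumTo n (λ z → if suc k ≤ᵇ z then h z else + 0)
sumTo-peel zero zero    h = sym (ZP.+-identityʳ _)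
sumTo-peel zero (suc k) h = refl
sumTo-peel (suc n) k h rewrite sumTo-peel n k h with k ≤? n
... | yes p rewrite ≤ᵇ-true p | ≤ᵇ-true (NP.m≤n⇒m≤1+n p) | ≤ᵇ-true (s≤s p) =
  ZP.+-assoc (h k) _ _
... | no p with k ≤? suc n
...   | yes q rewrite ≤ᵇ-false p | ≤ᵇ-true q | ≤ᵇ-false {suc k} {suc n} (λ r → p (NP.≤-pred r))
                    | NP.≤-antisym q (NP.≰⇒> p) =
  reorder (sumTo n (λ z → if suc (suc n) ≤ᵇ z then h z else + 0)) (h (suc n))
  where reorder : ∀ S a → (+ 0 + S) + a ≡ a + (S + + 0)
        reorder = solve-∀
...   | no q rewrite ≤ᵇ-false p | ≤ᵇ-false q
                   | ≤ᵇ-false {suc k} {suc n} (λ r → q (NP.≤-trans (NP.n≤1+n k) r)) =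
  ZP.+-assoc (+ 0) (sumTo n (λ z → if suc k ≤ᵇ z then h z else + 0)) (+ 0)

infixl 6 _⊖_
_⊖_ : Series → Series → Series
(f ⊖ g) n = f n - g n

qPow : ℕ → Series
qPow e = shift e one

⊛-cong : ∀ {f f' g g'} → f ≋ f' → g ≋ g' → (f ⊛ g) ≋ (f' ⊛ g')
⊛-cong e e' n = sumTo-cong n (λ j _ → cong₂ _*_ (e j) (e' (n ∸ j)))

⊖-cong : ∀ {f f' g g'} → f ≋ f' → g ≋ g' → (f ⊖ g) ≋ (f' ⊖ g')
⊖-cong e e' n = cong₂ _-_ (e n) (e' n)

shift-cong : ∀ a {f g} → f ≋ g → shift a f ≋ shift a g
shift-cong a e n with a ≤ᵇ n
... | true  = e (n ∸ a)
... | false = refl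

⊛-⊖ˡ : ∀ f g h → ((f ⊖ g) ⊛ h) ≋ ((f ⊛ h) ⊖ (g ⊛ h))
⊛-⊖ˡ f g h n = trans (sumTo-cong n (λ j _ → distribʳ (f j) (g j) (h (n ∸ j)))) (sumTo-− n _ _)
  where distribʳ : ∀ a b c → (a - b) * c ≡ a * c - b * c
        distribʳ = solve-∀

⊛-⊖ʳ : ∀ f g h → (h ⊛ (f ⊖ g)) ≋ ((h ⊛ f) ⊖ (h ⊛ g))
⊛-⊖ʳ f g h n = trans (sumTo-cong n (λ j _ → distribˡ (f (n ∸ j)) (g (n ∸ j)) (h j))) (sumTo-− n _ _)
  where distribˡ : ∀ a b c → c * (a - b) ≡ c * a - c * b
        distribˡ = solve-∀

shift-⊖ : ∀ a f g → shift a (f ⊖ g) ≋ (shift a f ⊖ shift a g)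
shift-⊖ a f g n with a ≤ᵇ n
... | true  = refl
... | false = refl

shift-+ : ∀ a f g n → shift a (λ i → f i + g i) n ≡ shift a f n + shift a g n
shift-+ a f g n with a ≤ᵇ n
... | true  = refl
... | false = refl

shift-shift : ∀ a b f → shift a (shift b f) ≋ shift (a ℕ.+ b) f
shift-shift a b f n with a ≤? n
... | yes p rewrite ≤ᵇ-true p | NP.∸-+-assoc n a b
                  | T-ext {b ≤ᵇ n ∸ a} {a ℕ.+ b ≤ᵇ n}
                      (λ t → NP.≤⇒≤ᵇ (subst (_≤ n) (NP.+-comm b a)
                                        (NP.m≤o∸n⇒m+n≤o b p (NP.≤ᵇ⇒≤ b (n ∸ a) t))))
                      (λ t → NP.≤⇒≤ᵇ (NP.m+n≤o⇒m≤o∸n b (subst (_≤ n) (NP.+-comm a b)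
                                                            (NP.≤ᵇ⇒≤ (a ℕ.+ b) n t)))) = refl
... | no p rewrite ≤ᵇ-false p | ≤ᵇ-false {a ℕ.+ b} {n} (λ q → p (NP.≤-trans (NP.m≤m+n a b) q)) =
  refl

shift-⊛ˡ : ∀ a f g → (shift a f ⊛ g) ≋ shift a (f ⊛ g)
shift-⊛ˡ a f g n =
  trans (sumTo-cong n (λ j p → trans (guard-*ʳ (a ≤ᵇ j) (f (j ∸ a)) (g (n ∸ j))) (reindex j p)))
        (sumTo-delay n a (λ i → f i * g ((n ∸ a) ∸ i)))
  where
  reindex : ∀ j → j ≤ n → (if a ≤ᵇ j then f (j ∸ a) * g (n ∸ j) else + 0)
                        ≡ (if a ≤ᵇ j then f (j ∸ a) * g ((n ∸ a) ∸ (j ∸ a)) else + 0)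
  reindex j p with a ≤? j
  ... | yes q rewrite ≤ᵇ-true q =
    cong (λ i → f (j ∸ a) * g i) (sym (trans (NP.∸-+-assoc n a (j ∸ a)) (cong (n ∸_) (NP.m+[n∸m]≡n q))))
  ... | no q rewrite ≤ᵇ-false q = refl

shift-⊛ʳ : ∀ a f g → (f ⊛ shift a g) ≋ shift a (f ⊛ g)
shift-⊛ʳ a f g n with a ≤? n
... | yes p rewrite ≤ᵇ-true p =
  trans (sumTo-cong n (λ j q → trans (guard-*ˡ (a ≤ᵇ n ∸ j) (g (n ∸ j ∸ a)) (f j))
                                     (cong₂ (λ b i → if b then f j * g i else + 0)
                                            (guard-swap q) (∸-swap j))))
        (sumTo-truncate n (n ∸ a) (λ j → f j * g (n ∸ a ∸ j)) (NP.m∸n≤m n a))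
  where
  guard-swap : ∀ {j} → j ≤ n → (a ≤ᵇ n ∸ j) ≡ (j ≤ᵇ n ∸ a)
  guard-swap {j} q = T-ext
    (λ t → NP.≤⇒≤ᵇ (NP.m+n≤o⇒m≤o∸n j (subst (_≤ n) (NP.+-comm a j)
                                         (NP.m≤o∸n⇒m+n≤o a q (NP.≤ᵇ⇒≤ a (n ∸ j) t)))))
    (λ t → NP.≤⇒≤ᵇ (NP.m+n≤o⇒m≤o∸n a (subst (_≤ n) (NP.+-comm j a)
                                         (NP.m≤o∸n⇒m+n≤o j p (NP.≤ᵇ⇒≤ j (n ∸ a) t)))))
  ∸-swap : ∀ j → n ∸ j ∸ a ≡ n ∸ a ∸ j
  ∸-swap j = trans (NP.∸-+-assoc n j a) (trans (cong (n ∸_) (NP.+-comm j a)) (sym (NP.∸-+-assoc n a j)))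
... | no p rewrite ≤ᵇ-false p =
  sumTo-zero n _ (λ j q → trans (guard-*ˡ (a ≤ᵇ n ∸ j) (g (n ∸ j ∸ a)) (f j))
                                (cong (λ b → if b then f j * g (n ∸ j ∸ a) else + 0)
                                      (≤ᵇ-false (λ r → p (NP.≤-trans r (NP.m∸n≤m n j))))))

⊛-one : ∀ f → (f ⊛ one) ≋ f
⊛-one f zero    = ZP.*-identityʳ (f 0)
⊛-one f (suc n) =
  trans (cong₂ _+_ (sumTo-zero n _ (λ j q → trans (cong (λ i → f j * one i) (NP.+-∸-assoc 1 q))
                                                  (ZP.*-zeroʳ (f j))))
                   (trans (cong (λ i → f (suc n) * one i) (NP.n∸n≡0 n)) (ZP.*-identityʳ (f (suc n)))))
        (ZP.+-identityˡ _)

oneMinusQ≋ : ∀ a → oneMinusQ a ≋ (one ⊖ qPow (suc a))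
oneMinusQ≋ a zero = refl
oneMinusQ≋ a (suc n) with n ℕ.≟ a
... | yes refl rewrite T⇒true (NP.≡⇒≡ᵇ n n refl) | ≤ᵇ-true (NP.≤-refl {suc n}) | NP.n∸n≡0 n = refl
... | no q rewrite T-ext {n ≡ᵇ a} {false} (q ∘ NP.≡ᵇ⇒≡ n a) (λ ()) with suc a ≤? suc n
...   | yes r rewrite ≤ᵇ-true r | NP.+-∸-assoc 1 (NP.≤∧≢⇒< (NP.≤-pred r) (q ∘ sym)) = refl
...   | no r  rewrite ≤ᵇ-false r = refl

-- δ a f = (1 - q^a) f
δ : ℕ → Series → Series
δ a f = f ⊖ shift a f

δ-cong : ∀ a {f g} → f ≋ g → δ a f ≋ δ a g
δ-cong a e = ⊖-cong e (shift-cong a e)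

δ-⊛ʳ : ∀ a f g → (f ⊛ δ a g) ≋ δ a (f ⊛ g)
δ-⊛ʳ a f g n = trans (⊛-⊖ʳ g (shift a g) f n) (cong (λ w → (f ⊛ g) n - w) (shift-⊛ʳ a f g n))

δ-⊛ˡ : ∀ a f g → (δ a f ⊛ g) ≋ δ a (f ⊛ g)
δ-⊛ˡ a f g n = trans (⊛-⊖ˡ f (shift a f) g n) (cong (λ w → (f ⊛ g) n - w) (shift-⊛ˡ a f g n))

δ-⊖ : ∀ a f g → (δ a f ⊖ δ a g) ≋ δ a (f ⊖ g)
δ-⊖ a f g n =
  trans (regroup (f n) (g n) (shift a f n) (shift a g n))
        (cong (λ w → (f n - g n) - w) (sym (shift-⊖ a f g n)))
  where regroup : ∀ x y u v → (x - u) - (y - v) ≡ (x - y) - (u - v)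
        regroup = solve-∀

qPoch-step : ∀ l → qPoch (suc l) ≋ δ (suc l) (qPoch l)
qPoch-step l n =
  trans (⊛-cong {qPoch l} (λ _ → refl) (oneMinusQ≋ l) n)
        (trans (δ-⊛ʳ (suc l) (qPoch l) one n) (δ-cong (suc l) (⊛-one (qPoch l)) n))

Q : ℕ → Series
Q l = qPoch l ⊛ qPoch l

⊛Q-step : ∀ l f → (f ⊛ Q (suc l)) ≋ δ (suc l) (δ (suc l) (f ⊛ Q l))
⊛Q-step l f n =
  trans (⊛-cong {f} (λ _ → refl) Q-step n)
        (trans (δ-⊛ʳ a f (δ a (Q l)) n) (δ-cong a (δ-⊛ʳ a f (Q l)) n))
  where
  a : ℕ
  a = suc l
  Q-step : Q (suc l) ≋ δ a (δ a (Q l))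
  Q-step n = trans (⊛-cong (qPoch-step l) (qPoch-step l) n)
                   (trans (δ-⊛ʳ a (δ a (qPoch l)) (qPoch l) n) (δ-cong a (δ-⊛ˡ a (qPoch l) (qPoch l)) n))

qPoch-const : ∀ l → qPoch l 0 ≡ + 1
qPoch-const zero    = refl
qPoch-const (suc l) rewrite qPoch-const l = refl

Q-const : ∀ l → Q l 0 ≡ + 1
Q-const l rewrite qPoch-const l = refl

⊛-cancelʳ : ∀ {A B R : Series} → R 0 ≡ + 1 → (A ⊛ R) ≋ (B ⊛ R) → A ≋ B
⊛-cancelʳ {A} {B} {R} R0 AR≋BR n = upTo-n n n NP.≤-refl
  where
  times-R0 : ∀ x i → i ≡ 0 → x * R i ≡ x
  times-R0 x i refl = trans (cong (x *_) R0) (ZP.*-identityʳ x)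
  upTo-n : ∀ n j → j ≤ n → A j ≡ B j
  upTo-n zero .zero z≤n =
    trans (sym (times-R0 (A 0) 0 refl)) (trans (AR≋BR 0) (times-R0 (B 0) 0 refl))
  upTo-n (suc n) j p with NP.m≤n⇒m<n∨m≡n p
  ... | inj₁ q    = upTo-n n j (NP.≤-pred q)
  ... | inj₂ refl =
    trans (sym (times-R0 (A (suc n)) (n ∸ n) (NP.n∸n≡0 n)))
   (trans (+-cancelˡ (sumTo n (λ i → B i * R (suc n ∸ i))) _ _ (trans (cong (_+ A (suc n) * R (n ∸ n)) (sym lower-terms)) (AR≋BR (suc n))))
          (times-R0 (B (suc n)) (n ∸ n) (NP.n∸n≡0 n)))
    where
    lower-terms : sumTo n (λ i → A i * R (suc n ∸ i)) ≡ sumTo n (λ i → B i * R (suc n ∸ i))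
    lower-terms = sumTo-cong n (λ i q → cong (_* R (suc n ∸ i)) (upTo-n n i q))

-- Telescoping: if ρ k vanishes below degree k and ρ k - ρ (k+1) = q^{a k} g,
-- then ρ k = Σ_{j ≥ k} q^{a j} g, hence (1 - q^a) ρ k = q^{a k} g.

VanishesBelow : ℕ → Series → Set
VanishesBelow k f = ∀ n → n < k → f n ≡ + 0

vanishes-⊛ : ∀ k f g → VanishesBelow k f → VanishesBelow k (f ⊛ g)
vanishes-⊛ k f g v n p = sumTo-zero n _ (λ j q → cong (_* g (n ∸ j)) (v j (NP.≤-<-trans q p)))

vanishes-shift : ∀ k a f → VanishesBelow k f → VanishesBelow k (shift a f)
vanishes-shift k a f v n p with a ≤ᵇ n
... | true  = v (n ∸ a) (NP.≤-<-trans (NP.m∸n≤m n a) p)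
... | false = refl

vanishes-δ : ∀ k a f → VanishesBelow k f → VanishesBelow k (δ a f)
vanishes-δ k a f v n p rewrite v n p | vanishes-shift k a f v n p = refl

module Telescope (a : ℕ) (g : Series) (ρ : ℕ → Series)
                 (vanish : ∀ k → VanishesBelow k (ρ k))
                 (step : ∀ k → (ρ k ⊖ ρ (suc k)) ≋ shift (a ℕ.* k) g) where

  unfold : ∀ k n → ρ k n ≡ shift (a ℕ.* k) g n + ρ (suc k) n
  unfold k n = trans (add-back (ρ k n) (ρ (suc k) n)) (cong (_+ ρ (suc k) n) (step k n))
    where add-back : ∀ x y → x ≡ (x - y) + y
          add-back = solve-∀

  shift-ρ : ∀ t k n → n < k ℕ.+ t → shift a (ρ k) n ≡ ρ (suc k) n
  shift-ρ zero k n p rewrite NP.+-identityʳ k =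
    trans (vanishes-shift k a (ρ k) (vanish k) n p) (sym (vanish (suc k) n (NP.m≤n⇒m≤1+n p)))
  shift-ρ (suc t) k n p = begin
    shift a (ρ k) n
      ≡⟨ shift-cong a (unfold k) n ⟩
    shift a (λ i → shift (a ℕ.* k) g i + ρ (suc k) i) n
      ≡⟨ shift-+ a (shift (a ℕ.* k) g) (ρ (suc k)) n ⟩
    shift a (shift (a ℕ.* k) g) n + shift a (ρ (suc k)) n
      ≡⟨ cong₂ _+_ (shift-shift a (a ℕ.* k) g n) (shift-ρ t (suc k) n (subst (n <_) (NP.+-suc k t) p)) ⟩
    shift (a ℕ.+ a ℕ.* k) g n + ρ (suc (suc k)) n
      ≡⟨ cong (λ e → shift e g n + ρ (suc (suc k)) n) (sym (NP.*-suc a k)) ⟩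
    shift (a ℕ.* suc k) g n + ρ (suc (suc k)) n
      ≡⟨ sym (unfold (suc k) n) ⟩
    ρ (suc k) n ∎
    where open ≡-Reasoning

  -- taking t = n+1 covers the degree n
  telescope : ∀ k → δ a (ρ k) ≋ shift (a ℕ.* k) g
  telescope k n =
    trans (cong (λ w → ρ k n - w) (shift-ρ (suc n) k n (NP.≤-trans (NP.n<1+n n) (NP.m≤n+m (suc n) k))))
          (step k n)

ΣL : ∀ {A : Set} → List A → (A → ℤ) → ℤ
ΣL xs f = sumList (map f xs)

ΣL-cong : ∀ {A : Set} (xs : List A) {f g : A → ℤ} → (∀ x → f x ≡ g x) → ΣL xs f ≡ ΣL xs g
ΣL-cong []       e = refl
ΣL-cong (x ∷ xs) e = cong₂ _+_ (e x) (ΣL-cong xs e)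

ΣL-zero : ∀ {A : Set} (xs : List A) f → (∀ x → f x ≡ + 0) → ΣL xs f ≡ + 0
ΣL-zero []       f z = refl
ΣL-zero (x ∷ xs) f z rewrite z x | ΣL-zero xs f z = refl

ΣL-++ : ∀ {A : Set} (xs ys : List A) f → ΣL (xs ++ ys) f ≡ ΣL xs f + ΣL ys f
ΣL-++ []       ys f = sym (ZP.+-identityˡ _)
ΣL-++ (x ∷ xs) ys f = trans (cong (_+_ (f x)) (ΣL-++ xs ys f)) (sym (ZP.+-assoc (f x) _ _))

ΣL-concatMap : ∀ {A B : Set} (F : A → List B) (xs : List A) h →
               ΣL (concatMap F xs) h ≡ ΣL xs (λ x → ΣL (F x) h)
ΣL-concatMap F []       h = refl
ΣL-concatMap F (x ∷ xs) h =
  trans (ΣL-++ (F x) (concatMap F xs) h) (cong (_+_ (ΣL (F x) h)) (ΣL-concatMap F xs h))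

ΣL-map : ∀ {A B : Set} (g : A → B) (ys : List A) h → ΣL (map g ys) h ≡ ΣL ys (h ∘ g)
ΣL-map g []       h = refl
ΣL-map g (y ∷ ys) h = cong (_+_ (h (g y))) (ΣL-map g ys h)

ΣL-+ : ∀ {A : Set} (xs : List A) f g → ΣL xs (λ x → f x + g x) ≡ ΣL xs f + ΣL xs g
ΣL-+ []       f g = refl
ΣL-+ (x ∷ xs) f g rewrite ΣL-+ xs f g = interchange (f x) (g x) (ΣL xs f) (ΣL xs g)
  where interchange : ∀ a b c d → (a + b) + (c + d) ≡ (a + c) + (b + d)
        interchange = solve-∀

ΣL-*ˡ : ∀ {A : Set} (xs : List A) c f → ΣL xs (λ x → c * f x) ≡ c * ΣL xs f
ΣL-*ˡ []       c f = sym (ZP.*-zeroʳ c)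
ΣL-*ˡ (x ∷ xs) c f rewrite ΣL-*ˡ xs c f = sym (ZP.*-distribˡ-+ c _ _)

ΣL-swap : ∀ {A B : Set} (xs : List A) (ys : List B) (F : A → B → ℤ) →
          ΣL xs (λ x → ΣL ys (F x)) ≡ ΣL ys (λ y → ΣL xs (λ x → F x y))
ΣL-swap []       ys F = sym (ΣL-zero ys _ (λ _ → refl))
ΣL-swap (x ∷ xs) ys F = trans (cong (_+_ (ΣL ys (F x))) (ΣL-swap xs ys F)) (sym (ΣL-+ ys (F x) _))

ΣL-applyUpTo : ∀ N (g : ℕ → ℕ) (f : ℕ → ℤ) → ΣL (applyUpTo g (suc N)) f ≡ sumTo N (f ∘ g)
ΣL-applyUpTo zero    g f = ZP.+-identityʳ _
ΣL-applyUpTo (suc N) g f =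
  trans (cong (_+_ (f (g 0))) (ΣL-applyUpTo N (g ∘ suc) f)) (sym (sumTo-unconsˡ N (f ∘ g)))

ΣL-upTo : ∀ N (f : ℕ → ℤ) → ΣL (upTo (suc N)) f ≡ sumTo N f
ΣL-upTo N = ΣL-applyUpTo N (λ x → x)

lists-cons : ∀ l N (h : List ℕ → ℤ) →
  ΣL (lists (suc l) N) h ≡ ΣL (upTo (suc N)) (λ x → ΣL (lists l N) (λ ρ → h (x ∷ ρ)))
lists-cons l N h = trans (ΣL-concatMap (λ x → map (x ∷_) (lists l N)) (upTo (suc N)) h)
                         (ΣL-cong (upTo (suc N)) (λ x → ΣL-map (x ∷_) (lists l N) h))

lists-snoc : ∀ l N (h : List ℕ → ℤ) →
  ΣL (lists (suc l) N) h ≡ ΣL (lists l N) (λ ρ → ΣL (upTo (suc N)) (λ z → h (ρ ++ z ∷ [])))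
lists-snoc zero N h =
  trans (lists-cons zero N h)
        (trans (ΣL-cong (upTo (suc N)) (λ x → ZP.+-identityʳ (h (x ∷ [])))) (sym (ZP.+-identityʳ _)))
lists-snoc (suc l) N h =
  trans (lists-cons (suc l) N h)
  (trans (ΣL-cong (upTo (suc N)) (λ x → lists-snoc l N (λ ρ → h (x ∷ ρ))))
         (sym (lists-cons l N (λ ρ → ΣL (upTo (suc N)) (λ z → h (ρ ++ z ∷ []))))))

SupportedBy : ℕ → (List ℕ → ℤ) → Set
SupportedBy n h = ∀ ρ → Any (n <_) ρ → h ρ ≡ + 0

lists-bound : ∀ l {n N} (h : List ℕ → ℤ) → n ≤ N → SupportedBy n h →
              ΣL (lists l N) h ≡ ΣL (lists l n) h
lists-bound zero    h p supp = refl
lists-bound (suc l) {n} {N} h p supp = begin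
  ΣL (lists (suc l) N) h
    ≡⟨ lists-cons l N h ⟩
  ΣL (upTo (suc N)) (λ x → ΣL (lists l N) (λ ρ → h (x ∷ ρ)))
    ≡⟨ ΣL-upTo N _ ⟩
  sumTo N (λ x → ΣL (lists l N) (λ ρ → h (x ∷ ρ)))
    ≡⟨ sumTo-extend N _ p (λ x n<x _ → ΣL-zero (lists l N) _ (λ ρ → supp (x ∷ ρ) (here n<x))) ⟩
  sumTo n (λ x → ΣL (lists l N) (λ ρ → h (x ∷ ρ)))
    ≡⟨ sumTo-cong n (λ x _ → lists-bound l (λ ρ → h (x ∷ ρ)) p (λ ρ a → supp (x ∷ ρ) (there a))) ⟩
  sumTo n (λ x → ΣL (lists l n) (λ ρ → h (x ∷ ρ)))
    ≡⟨ sym (ΣL-upTo n _) ⟩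
  ΣL (upTo (suc n)) (λ x → ΣL (lists l n) (λ ρ → h (x ∷ ρ)))
    ≡⟨ sym (lists-cons l n h) ⟩
  ΣL (lists (suc l) n) h ∎
  where open ≡-Reasoning

entry<⇒sum< : ∀ {n} ρ → Any (n <_) ρ → n < ListAction.sum ρ
entry<⇒sum< (x ∷ ρ) (here p)  = NP.≤-trans p (NP.m≤m+n x _)
entry<⇒sum< (x ∷ ρ) (there a) = NP.≤-trans (entry<⇒sum< ρ a) (NP.m≤n+m _ x)

-- The weighted generating function of P_l(k,m) and its recursion

module Count (m : ℕ) where

  term : ℕ → List ℕ → ℕ → ℤ
  term k π n = if inP k m π ∧ (ListAction.sum π ≡ᵇ n) then ω k m π else + 0

  W : ℕ → ℕ → Series
  W l k n = ΣL (lists l n) (λ π → term k π n)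

  term-supported : ∀ k n → SupportedBy n (λ ρ → term k ρ n)
  term-supported k n ρ big with inP k m ρ
  ... | false = refl
  ... | true with ListAction.sum ρ ≡ᵇ n in eq
  ...   | false = refl
  ...   | true  = ⊥-elim (NP.<-irrefl (sym (NP.≡ᵇ⇒≡ _ _ (subst T (sym eq) tt))) (entry<⇒sum< ρ big))

  inP-snoc : ∀ k z ρ → inP k m (ρ ++ z ∷ []) ≡ inP (z ℕ.+ m) m ρ ∧ (k ≤ᵇ z)
  inP-snoc k z [] = refl
  inP-snoc k z (x ∷ []) with (z ℕ.+ m) ≤ᵇ x in eq
  ... | true rewrite ≤ᵇ-true {z} {x} (NP.m+n≤o⇒m≤o z (NP.≤ᵇ⇒≤ (z ℕ.+ m) x (subst T (sym eq) tt))) = refl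
  ... | false = BP.∧-zeroʳ (z ≤ᵇ x)
  inP-snoc k z (x ∷ y ∷ r) rewrite inP-snoc k z (y ∷ r) =
    sym (trans (BP.∧-assoc (y ≤ᵇ x) (((y ℕ.+ m) ≤ᵇ x) ∧ inP (z ℕ.+ m) m (y ∷ r)) (k ≤ᵇ z))
               (cong ((y ≤ᵇ x) ∧_) (BP.∧-assoc ((y ℕ.+ m) ≤ᵇ x) (inP (z ℕ.+ m) m (y ∷ r)) (k ≤ᵇ z))))

  ω-snoc : ∀ k z ρ → ω k m (ρ ++ z ∷ []) ≡ (+ z + + 1 - + k) * ω (z ℕ.+ m) m ρ
  ω-snoc k z [] = sym (ZP.*-identityʳ _)
  ω-snoc k z (x ∷ []) rewrite ZP.pos-+ z m = lastGap (+ x) (+ z) (+ m) (+ k)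
    where lastGap : ∀ X Z M K → (X - Z + + 1 - M) * (Z + + 1 - K) ≡ (Z + + 1 - K) * (X + + 1 - (Z + M))
          lastGap = solve-∀
  ω-snoc k z (x ∷ y ∷ r) rewrite ω-snoc k z (y ∷ r) =
    commute (+ x - + y + + 1 - + m) (+ z + + 1 - + k) (ω (z ℕ.+ m) m (y ∷ r))
    where commute : ∀ a c w → a * (c * w) ≡ c * (a * w)
          commute = solve-∀

  sum-snoc : ∀ (ρ : List ℕ) z → ListAction.sum (ρ ++ z ∷ []) ≡ ListAction.sum ρ ℕ.+ z
  sum-snoc []      z = NP.+-identityʳ z
  sum-snoc (x ∷ ρ) z rewrite sum-snoc ρ z = sym (NP.+-assoc x _ z)

  +≡ᵇ⇔≡ᵇ∸ : ∀ s {z n} → z ≤ n → (s ℕ.+ z ≡ᵇ n) ≡ (s ≡ᵇ n ∸ z)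
  +≡ᵇ⇔≡ᵇ∸ s {z} {n} z≤n′ = T-ext
    (λ t → NP.≡⇒≡ᵇ s (n ∸ z) (trans (sym (NP.m+n∸n≡m s z)) (cong (_∸ z) (NP.≡ᵇ⇒≡ _ _ t))))
    (λ t → NP.≡⇒≡ᵇ (s ℕ.+ z) n (trans (cong (ℕ._+ z) (NP.≡ᵇ⇒≡ _ _ t)) (NP.m∸n+n≡m z≤n′)))

  smallest : ℕ → ℕ → ℤ
  smallest k z = if k ≤ᵇ z then + z + + 1 - + k else + 0

  term-snoc : ∀ k z n ρ → z ≤ n → term k (ρ ++ z ∷ []) n ≡ smallest k z * term (z ℕ.+ m) ρ (n ∸ z)
  term-snoc k z n ρ z≤n′
    rewrite inP-snoc k z ρ | sum-snoc ρ z | +≡ᵇ⇔≡ᵇ∸ (ListAction.sum ρ) z≤n′ | ω-snoc k z ρ =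
    split (inP (z ℕ.+ m) m ρ) (k ≤ᵇ z) (ListAction.sum ρ ≡ᵇ n ∸ z) _ _
    where
    split : ∀ A B C (x y : ℤ) →
      (if (A ∧ B) ∧ C then x * y else + 0) ≡ (if B then x else + 0) * (if A ∧ C then y else + 0)
    split true  true  true  x y = refl
    split true  true  false x y = sym (ZP.*-zeroʳ x)
    split true  false C     x y = refl
    split false B     C     x y = sym (ZP.*-zeroʳ (if B then x else + 0))

  W-suc : ∀ l k n → W (suc l) k n ≡ sumTo n (λ z → smallest k z * W l (z ℕ.+ m) (n ∸ z))
  W-suc l k n = begin
    ΣL (lists (suc l) n) (λ π → term k π n)
      ≡⟨ lists-snoc l n (λ π → term k π n) ⟩
    ΣL (lists l n) (λ ρ → ΣL (upTo (suc n)) (λ z → term k (ρ ++ z ∷ []) n))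
      ≡⟨ ΣL-swap (lists l n) (upTo (suc n)) (λ ρ z → term k (ρ ++ z ∷ []) n) ⟩
    ΣL (upTo (suc n)) (λ z → ΣL (lists l n) (λ ρ → term k (ρ ++ z ∷ []) n))
      ≡⟨ ΣL-upTo n _ ⟩
    sumTo n (λ z → ΣL (lists l n) (λ ρ → term k (ρ ++ z ∷ []) n))
      ≡⟨ sumTo-cong n lastPart ⟩
    sumTo n (λ z → smallest k z * W l (z ℕ.+ m) (n ∸ z)) ∎
    where
    open ≡-Reasoning
    lastPart : ∀ z → z ≤ n →
      ΣL (lists l n) (λ ρ → term k (ρ ++ z ∷ []) n) ≡ smallest k z * W l (z ℕ.+ m) (n ∸ z)
    lastPart z z≤n′ =
      trans (ΣL-cong (lists l n) (λ ρ → term-snoc k z n ρ z≤n′))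
     (trans (ΣL-*ˡ (lists l n) (smallest k z) _)
            (cong (smallest k z *_)
                  (lists-bound l (λ ρ → term (z ℕ.+ m) ρ (n ∸ z)) (NP.m∸n≤m n z)
                               (term-supported (z ℕ.+ m) (n ∸ z)))))

  smallest-diff : ∀ k z X → smallest k z * X - smallest (suc k) z * X ≡ (if k ≤ᵇ z then X else + 0)
  smallest-diff k z X with k ≤? z
  ... | no p rewrite ≤ᵇ-false p | ≤ᵇ-false {suc k} {z} (λ q → p (NP.≤-trans (NP.n≤1+n k) q)) = refl
  ... | yes p with suc k ≤? z
  ...   | yes q rewrite ≤ᵇ-true p | ≤ᵇ-true q | ZP.pos-+ 1 k = unitStep (+ z) (+ k) X
    where unitStep : ∀ Z K X → (Z + + 1 - K) * X - (Z + + 1 - (+ 1 + K)) * X ≡ X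
          unitStep = solve-∀
  ...   | no q rewrite ≤ᵇ-true p | ≤ᵇ-false q | NP.≤-antisym p (NP.≤-pred (NP.≰⇒> q)) = lastStep (+ z) X
    where lastStep : ∀ Z X → (Z + + 1 - Z) * X - + 0 * X ≡ X
          lastStep = solve-∀

  Tail : ℕ → ℕ → Series
  Tail l k n = sumTo n (λ z → if k ≤ᵇ z then W l (z ℕ.+ m) (n ∸ z) else + 0)

  W-diff : ∀ l k → (W (suc l) k ⊖ W (suc l) (suc k)) ≋ Tail l k
  W-diff l k n =
    trans (cong₂ _-_ (W-suc l k n) (W-suc l (suc k) n))
   (trans (sym (sumTo-− n _ _)) (sumTo-cong n (λ z _ → smallest-diff k z (W l (z ℕ.+ m) (n ∸ z)))))

  Tail-diff : ∀ l k → (Tail l k ⊖ Tail l (suc k)) ≋ shift k (W l (k ℕ.+ m))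
  Tail-diff l k n =
    trans (cong (_- Tail l (suc k) n) (sumTo-peel n k (λ z → W l (z ℕ.+ m) (n ∸ z))))
          (cancel (shift k (W l (k ℕ.+ m)) n) (Tail l (suc k) n))
    where cancel : ∀ a b → (a + b) - b ≡ a
          cancel = solve-∀

  W-vanishes : ∀ l k → VanishesBelow k (W (suc l) k)
  W-vanishes l k n n<k = trans (W-suc l k n) (sumTo-zero n _ (λ z z≤n′ →
    cong (λ b → (if b then + z + + 1 - + k else + 0) * W l (z ℕ.+ m) (n ∸ z))
         (≤ᵇ-false (NP.<⇒≱ (NP.≤-<-trans z≤n′ n<k)))))

  Tail-vanishes : ∀ l k → VanishesBelow k (Tail l k)
  Tail-vanishes l k n n<k = sumTo-zero n _ (λ z z≤n′ →
    cong (λ b → if b then W l (z ℕ.+ m) (n ∸ z) else + 0) (≤ᵇ-false (NP.<⇒≱ (NP.≤-<-trans z≤n′ n<k))))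

-- The main identity  W l k · (q;q)_l² = q^{m·C(l,2) + k·l}

module Main (m : ℕ) where
  open Count m

  exponent : ℕ → ℕ → ℕ
  exponent l k = m ℕ.* (l C 2) ℕ.+ k ℕ.* l

  -- only the empty partition has length 0
  main-zero : ∀ k → (W 0 k ⊛ Q 0) ≋ qPow (exponent 0 k)
  main-zero k n rewrite NP.*-zeroʳ m | NP.*-zeroʳ k =
    trans (⊛-cong {W 0 k} (λ _ → refl) (⊛-one one) n) (trans (⊛-one (W 0 k) n) (W-zero n))
    where W-zero : W 0 k ≋ one
          W-zero zero    = refl
          W-zero (suc n) = refl

  module Step (l : ℕ) (ih : ∀ k → (W l k ⊛ Q l) ≋ qPow (exponent l k)) where

    a offset : ℕ
    a      = suc l
    offset = m ℕ.* (l C 2) ℕ.+ m ℕ.* l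

    exponent-tail : ∀ j → j ℕ.+ exponent l (j ℕ.+ m) ≡ a ℕ.* j ℕ.+ offset
    exponent-tail j = arith j m l (l C 2)
      where arith : ∀ j m l c → j ℕ.+ (m ℕ.* c ℕ.+ (j ℕ.+ m) ℕ.* l)
                              ≡ (1 ℕ.+ l) ℕ.* j ℕ.+ (m ℕ.* c ℕ.+ m ℕ.* l)
            arith = NatSolver.solve-∀

    exponent-suc : ∀ k → a ℕ.* k ℕ.+ offset ≡ exponent (suc l) k
    exponent-suc k =
      trans (arith l k m (l C 2)) (cong (λ c → m ℕ.* c ℕ.+ k ℕ.* suc l) (sym C2-suc))
      where arith : ∀ l k m c → (1 ℕ.+ l) ℕ.* k ℕ.+ (m ℕ.* c ℕ.+ m ℕ.* l)
                              ≡ m ℕ.* (l ℕ.+ c) ℕ.+ k ℕ.* (1 ℕ.+ l)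
            arith = NatSolver.solve-∀
            C2-suc : suc l C 2 ≡ l ℕ.+ l C 2
            C2-suc = trans (sym (nCk+nC[k+1]≡[n+1]C[k+1] l 1)) (cong (ℕ._+ l C 2) (nC1≡n l))

    tail-step : ∀ j → ((Tail l j ⊛ Q l) ⊖ (Tail l (suc j) ⊛ Q l)) ≋ shift (a ℕ.* j) (qPow offset)
    tail-step j n = begin
      ((Tail l j ⊛ Q l) ⊖ (Tail l (suc j) ⊛ Q l)) n
        ≡⟨ sym (⊛-⊖ˡ (Tail l j) (Tail l (suc j)) (Q l) n) ⟩
      ((Tail l j ⊖ Tail l (suc j)) ⊛ Q l) n
        ≡⟨ ⊛-cong {g = Q l} {g' = Q l} (Tail-diff l j) (λ _ → refl) n ⟩
      (shift j (W l (j ℕ.+ m)) ⊛ Q l) n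
        ≡⟨ shift-⊛ˡ j (W l (j ℕ.+ m)) (Q l) n ⟩
      shift j (W l (j ℕ.+ m) ⊛ Q l) n
        ≡⟨ shift-cong j (ih (j ℕ.+ m)) n ⟩
      shift j (qPow (exponent l (j ℕ.+ m))) n
        ≡⟨ shift-shift j (exponent l (j ℕ.+ m)) one n ⟩
      qPow (j ℕ.+ exponent l (j ℕ.+ m)) n
        ≡⟨ cong (λ e → qPow e n) (exponent-tail j) ⟩
      qPow (a ℕ.* j ℕ.+ offset) n
        ≡⟨ sym (shift-shift (a ℕ.* j) offset one n) ⟩
      shift (a ℕ.* j) (qPow offset) n ∎
      where open ≡-Reasoning

    tail-telescope : ∀ j → δ a (Tail l j ⊛ Q l) ≋ shift (a ℕ.* j) (qPow offset)
    tail-telescope = Telescope.telescope a (qPow offset) (λ j → Tail l j ⊛ Q l)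
      (λ j → vanishes-⊛ j (Tail l j) (Q l) (Tail-vanishes l j)) tail-step

    W-step : ∀ j → (δ a (W (suc l) j ⊛ Q l) ⊖ δ a (W (suc l) (suc j) ⊛ Q l)) ≋ shift (a ℕ.* j) (qPow offset)
    W-step j n = begin
      (δ a (W (suc l) j ⊛ Q l) ⊖ δ a (W (suc l) (suc j) ⊛ Q l)) n
        ≡⟨ δ-⊖ a (W (suc l) j ⊛ Q l) (W (suc l) (suc j) ⊛ Q l) n ⟩
      δ a ((W (suc l) j ⊛ Q l) ⊖ (W (suc l) (suc j) ⊛ Q l)) n
        ≡⟨ δ-cong a (λ i → sym (⊛-⊖ˡ (W (suc l) j) (W (suc l) (suc j)) (Q l) i)) n ⟩
      δ a ((W (suc l) j ⊖ W (suc l) (suc j)) ⊛ Q l) n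
        ≡⟨ δ-cong a (⊛-cong {g = Q l} {g' = Q l} (W-diff l j) (λ _ → refl)) n ⟩
      δ a (Tail l j ⊛ Q l) n
        ≡⟨ tail-telescope j n ⟩
      shift (a ℕ.* j) (qPow offset) n ∎
      where open ≡-Reasoning

    W-telescope : ∀ k → δ a (δ a (W (suc l) k ⊛ Q l)) ≋ shift (a ℕ.* k) (qPow offset)
    W-telescope = Telescope.telescope a (qPow offset) (λ j → δ a (W (suc l) j ⊛ Q l))
      (λ j → vanishes-δ j a _ (vanishes-⊛ j (W (suc l) j) (Q l) (W-vanishes l j))) W-step

    main-suc : ∀ k → (W (suc l) k ⊛ Q (suc l)) ≋ qPow (exponent (suc l) k)
    main-suc k n = begin
      (W (suc l) k ⊛ Q (suc l)) n              ≡⟨ ⊛Q-step l (W (suc l) k) n ⟩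
      δ a (δ a (W (suc l) k ⊛ Q l)) n          ≡⟨ W-telescope k n ⟩
      shift (a ℕ.* k) (qPow offset) n            ≡⟨ shift-shift (a ℕ.* k) offset one n ⟩
      qPow (a ℕ.* k ℕ.+ offset) n                ≡⟨ cong (λ e → qPow e n) (exponent-suc k) ⟩
      qPow (exponent (suc l) k) n                ∎
      where open ≡-Reasoning

  main : ∀ l k → (W l k ⊛ Q l) ≋ qPow (exponent l k)
  main zero    = main-zero
  main (suc l) = Step.main-suc l (main l)

-- Corollary 6.  Since (q;q)_l² has constant term 1 it can be cancelled from
-- (main) and from D l · (q;q)_l² = 1, giving W l k = q^{exponent l k} D l;
-- summing over l ≤ M gives the claim.

corollary6 : (M k m : ℕ) → 1 ≤ k →
    (D : ℕ → Series) → (∀ i → (D i ⊛ (qPoch i ⊛ qPoch i)) ≋ one) →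
    lhsSeries M k m ≋ rhsSeries M k m D
corollary6 M k m _ D D-inverse n = sumTo-cong M (λ l _ → W≋ l n)
  where
  open Count m
  open Main m
  W≋ : ∀ l → W l k ≋ shift (exponent l k) (D l)
  W≋ l = ⊛-cancelʳ {R = Q l} (Q-const l) (λ n → begin
    (W l k ⊛ Q l) n                           ≡⟨ main l k n ⟩
    qPow (exponent l k) n                       ≡⟨ shift-cong (exponent l k) (λ i → sym (D-inverse l i)) n ⟩
    shift (exponent l k) (D l ⊛ Q l) n        ≡⟨ sym (shift-⊛ˡ (exponent l k) (D l) (Q l) n) ⟩
    (shift (exponent l k) (D l) ⊛ Q l) n      ∎)
    where open ≡-Reasoning
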